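{- The maps $\mathsf{LtoBw}$ (from $\lambda$-terms to black-white trees with black root) and $\mathsf{BwtoL}$ (from black-white trees with black root to $\lambda$-terms) defined below are mutually inverse bijections, i.e. $\mathsf{BwtoL}\circ\mathsf{LtoBw}$ is the identity on $\lambda$-terms and $\mathsf{LtoBw}\circ\mathsf{BwtoL}$ is the identity on black-white trees with black root.
   Context: $\lambda$-terms in de Bruijn notation are generated by $T ::= \underline{\mathsf{n}} \mid \lambda T \mid T\,T$, where indices are generated by $\underline{\mathsf{0}}$ and $S\,\underline{\mathsf{n}}$. A black-white tree is a finite rooted binary tree (each node has an optional left child and an optional right child) whose nodes are coloured black or white, such that the only allowed parent–child edges are: black parent with black left child, black parent with white left child, white parent with white left child, white parent with black right child (so black nodes have no right child, and a white node's left child, if any, is white and its right child, if any, is black). The leftmost node of a tree is the node reached from the root by following left children as long as possible. For a tree $t$ and a node $x$, "attach $x$ at the leftmost position of $t$" means making $x$ the left child of the leftmost node of $t$. Define $\mathsf{LtoBw}$ recursively: $\mathsf{LtoBw}(\underline{\mathsf{0}})$ is a single black node; $\mathsf{LtoBw}(S\,\underline{\mathsf{n}})$ is $\mathsf{LtoBw}(\underline{\mathsf{n}})$ with a new black leaf attached at the leftmost position; $\mathsf{LtoBw}(\lambda M)$ is $\mathsf{LtoBw}(M)$ with a new white leaf attached at the leftmost position; $\mathsf{LtoBw}(M_1M_2)$ is $\mathsf{LtoBw}(M_2)$ with a new white node attached at the leftmost position, this white node having no left child and having $\mathsf{LtoBw}(M_1)$ as its right subtree. Define $\mathsf{BwtoL}$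 by decomposition at the leftmost node $v$: a single black node maps to $\underline{\mathsf{0}}$; otherwise $v$ is not the root; if $v$ is black, remove it, obtaining $t$, and map to $S\,\mathsf{BwtoL}(t)$; if $v$ is white without right child, remove it, obtaining $t$, and map to $\lambda\,\mathsf{BwtoL}(t)$; if $v$ is white with right subtree $t_1$, remove $v$ together with $t_1$, obtaining $t_2$, and map to $\mathsf{BwtoL}(t_1)\,\mathsf{BwtoL}(t_2)$. -}

module Defs where

open import Data.Nat using (ℕ; zero; suc; _+_)
open import Data.Unit using (⊤)
open import Data.Empty using (⊥)
open import Data.Product using (_×_; _,_)
open import Relation.Binary.PropositionalEquality using (_≡_)

-- λ-terms in de Bruijn notation:  T ::= n | λ T | T T,  n ::= 0 | S n

data Index : Set where
  𝟘 : Index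
  S : Index → Index

data Term : Set where
  var : Index → Term
  lam : Term → Term
  app : Term → Term → Term

-- Raw finite binary trees with coloured nodes (ε = absent child)

data Colour : Set where
  black white : Colour

data Tree : Set where
  ε    : Tree
  node : Colour → Tree → Tree → Tree   -- colour, left child, right child

LeftOK : Colour → Tree → Set
LeftOK _     ε              = ⊤
LeftOK black (node _ _ _)   = ⊤
LeftOK white (node c _ _)   = c ≡ white

RightOK : Colour → Tree → Set
RightOK _     ε             = ⊤
RightOK black (node _ _ _)  = ⊥
RightOK white (node c _ _)  = c ≡ black

IsBW : Tree → Set
IsBW ε              = ⊤
IsBW (node c l r)   = LeftOK c l × RightOK c r × IsBW l × IsBW r

BlackRoot : Tree → Set
BlackRoot ε                = ⊥
BlackRoot (node black _ _) = ⊤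
BlackRoot (node white _ _) = ⊥

IsBWB : Tree → Set
IsBWB t = IsBW t × BlackRoot t

-- attach x at the leftmost position of t (x becomes the left child of the
-- leftmost node of t); on the empty tree (never used) it returns x.
attachLeftmost : Tree → Tree → Tree
attachLeftmost ε              x = x
attachLeftmost (node c ε r)   x = node c x r
attachLeftmost (node c l@(node _ _ _) r) x = node c (attachLeftmost l x) r

LtoBw : Term → Tree
LtoBwIdx : Index → Tree
LtoBwIdx 𝟘     = node black ε ε
LtoBwIdx (S n) = attachLeftmost (LtoBwIdx n) (node black ε ε)
LtoBw (var n)     = LtoBwIdx n
LtoBw (lam M)     = attachLeftmost (LtoBw M) (node white ε ε)
LtoBw (app M₁ M₂) = attachLeftmost (LtoBw M₂) (node white ε (LtoBw M₁))

-- colour of the leftmost node (junk value on ε)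
leftmostColour : Tree → Colour
leftmostColour ε                        = black
leftmostColour (node c ε _)             = c
leftmostColour (node _ l@(node _ _ _) _) = leftmostColour l

leftmostRight : Tree → Tree
leftmostRight ε                        = ε
leftmostRight (node _ ε r)             = r
leftmostRight (node _ l@(node _ _ _) _) = leftmostRight l

removeLeftmost : Tree → Tree
removeLeftmost ε                        = ε
removeLeftmost (node _ ε _)             = ε
removeLeftmost (node c l@(node _ _ _) r) = node c (removeLeftmost l) r

size : Tree → ℕ
size ε            = 0
size (node _ l r) = suc (size l + size r)

-- S applied to a term; only meaningful on indices (junk otherwise, never
-- reached on black-white trees with black root)
sucT : Term → Term
sucT (var n) = var (S n)
sucT t       = t

-- BwtoL by decomposition at the leftmost node.  The recursion is on the
-- number of nodes (fuel = size t suffices, since every recursive call is on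
-- a strictly smaller tree); the fuel-exhausted / empty-tree cases are junk
-- and unreachable for nonempty trees.
BwtoL-fuel : ℕ → Tree → Term
BwtoL-fuel zero    _ = var 𝟘
BwtoL-fuel (suc k) t = step (leftmostColour t) (leftmostRight t) t
  where
  step : Colour → Tree → Tree → Term
  step _ _ ε                   = var 𝟘
  step _ _ (node black ε ε)    = var 𝟘
  step black _ t               = sucT (BwtoL-fuel k (removeLeftmost t))
  step white ε t               = lam (BwtoL-fuel k (removeLeftmost t))
  step white t₁@(node _ _ _) t = app (BwtoL-fuel k t₁) (BwtoL-fuel k (removeLeftmost t))

BwtoL : Tree → Term
BwtoL t = BwtoL-fuel (size t) t

module Submission where

-- Both maps are governed by one operation: attaching a node x = (c, no left
-- child, right subtree r) at the leftmost position of a nonempty tree t.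
-- LtoBw is defined by such attachments, and BwtoL undoes one: the leftmost
-- node of  attachLeftmost t x  is x itself and removing it gives back t.

open import Defs
open import Data.Product using (_×_; _,_; Σ; proj₁; proj₂)
open import Data.Unit using (⊤; tt)
open import Data.Empty using (⊥)
open import Data.Nat using (ℕ; zero; suc; _+_; _≤_; _<_; z≤n; s≤s)
open import Data.Nat.Properties using (≤-trans; ≤-pred; ≤-refl; +-monoˡ-<; m≤m+n; n≤1+n)
open import Relation.Binary.PropositionalEquality
  using (_≡_; refl; sym; trans; cong; cong₂; subst; module ≡-Reasoning)

open ≡-Reasoning

IsNode : Tree → Set
IsNode ε            = ⊥
IsNode (node _ _ _) = ⊤

leftChild : Tree → Tree
leftChild ε            = ε
leftChild (node _ l _) = l

-- The root has a left child, so the root is not the leftmost node.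
HasLeftChild : Tree → Set
HasLeftChild t = IsNode (leftChild t)

attach-node : ∀ c l r x → attachLeftmost (node c l r) x ≡ node c (attachLeftmost l x) r
attach-node c ε            r x = refl
attach-node c (node _ _ _) r x = refl

attach-isNode : ∀ t x → IsNode x → IsNode (attachLeftmost t x)
attach-isNode ε                        x nx = nx
attach-isNode (node _ ε _)             x _  = tt
attach-isNode (node _ (node _ _ _) _)  x _  = tt

attach-hasLeftChild : ∀ t x → IsNode t → IsNode x → HasLeftChild (attachLeftmost t x)
attach-hasLeftChild (node _ ε _)            x _ nx = nx
attach-hasLeftChild (node _ l@(node _ _ _) _) x _ nx = attach-isNode l x nx

leftmostColour-skip : ∀ c u r → IsNode u → leftmostColour (node c u r) ≡ leftmostColour u
leftmostColour-skip c (node _ _ _) r _ = refl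

leftmostRight-skip : ∀ c u r → IsNode u → leftmostRight (node c u r) ≡ leftmostRight u
leftmostRight-skip c (node _ _ _) r _ = refl

removeLeftmost-skip : ∀ c u r → IsNode u → removeLeftmost (node c u r) ≡ node c (removeLeftmost u) r
removeLeftmost-skip c (node _ _ _) r _ = refl

module Attached (c : Colour) (r : Tree) where

  x : Tree
  x = node c ε r

  attach-leftmostColour : ∀ t → leftmostColour (attachLeftmost t x) ≡ c
  attach-leftmostColour ε                          = refl
  attach-leftmostColour (node _ ε _)               = refl
  attach-leftmostColour (node a l@(node _ _ _) d)  =
    trans (leftmostColour-skip a (attachLeftmost l x) d (attach-isNode l x tt))
          (attach-leftmostColour l)

  attach-leftmostRight : ∀ t → leftmostRight (attachLeftmost t x) ≡ r
  attach-leftmostRight ε                         = refl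
  attach-leftmostRight (node _ ε _)              = refl
  attach-leftmostRight (node a l@(node _ _ _) d) =
    trans (leftmostRight-skip a (attachLeftmost l x) d (attach-isNode l x tt))
          (attach-leftmostRight l)

  attach-removeLeftmost : ∀ t → removeLeftmost (attachLeftmost t x) ≡ t
  attach-removeLeftmost ε                         = refl
  attach-removeLeftmost (node _ ε _)              = refl
  attach-removeLeftmost (node a l@(node _ _ _) d) =
    trans (removeLeftmost-skip a (attachLeftmost l x) d (attach-isNode l x tt))
          (cong (λ u → node a u d) (attach-removeLeftmost l))

open Attached using (attach-leftmostColour; attach-leftmostRight; attach-removeLeftmost)

decompose : ∀ t → IsNode t →
  t ≡ attachLeftmost (removeLeftmost t) (node (leftmostColour t) ε (leftmostRight t))
decompose (node c ε r)              _ = refl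
decompose (node c l@(node _ _ _) r) _ = begin
  node c l r                                        ≡⟨ cong (λ u → node c u r) (decompose l tt) ⟩
  node c (attachLeftmost (removeLeftmost l) x) r    ≡⟨ sym (attach-node c (removeLeftmost l) r x) ⟩
  attachLeftmost (node c (removeLeftmost l) r) x    ∎
  where
  x : Tree
  x = node (leftmostColour l) ε (leftmostRight l)

removeLeftmost-< : ∀ c l r → size (removeLeftmost (node c l r)) < size (node c l r)
removeLeftmost-< c ε            r = s≤s z≤n
removeLeftmost-< c (node a b d) r = s≤s (+-monoˡ-< (size r) (removeLeftmost-< a b d))

leftmostRight-< : ∀ c l r → size (leftmostRight (node c l r)) < size (node c l r)
leftmostRight-< c ε            r = ≤-refl
leftmostRight-< c (node a b d) r =
  ≤-trans (leftmostRight-< a b d) (≤-trans (m≤m+n _ (size r)) (n≤1+n _))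

removeLeftmost-≤ : ∀ k t → size t ≤ suc k → size (removeLeftmost t) ≤ k
removeLeftmost-≤ k ε            _ = z≤n
removeLeftmost-≤ k (node c l r) p = ≤-pred (≤-trans (removeLeftmost-< c l r) p)

leftmostRight-≤ : ∀ k t → size t ≤ suc k → size (leftmostRight t) ≤ k
leftmostRight-≤ k ε            _ = z≤n
leftmostRight-≤ k (node c l r) p = ≤-pred (≤-trans (leftmostRight-< c l r) p)

leftOK-root : ∀ c a u v u′ v′ → LeftOK c (node a u v) → LeftOK c (node a u′ v′)
leftOK-root black a u v u′ v′ p = p
leftOK-root white a u v u′ v′ p = p

leftOK-white : ∀ c u v → LeftOK c (node white u v)
leftOK-white black u v = tt
leftOK-white white u v = refl

leftOK-black : ∀ t → LeftOK black t
leftOK-black ε            = tt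
leftOK-black (node _ _ _) = tt

attach-BW : ∀ t x → IsNode t → IsBW t → IsBW x → LeftOK (leftmostColour t) x →
  IsBW (attachLeftmost t x)
attach-BW (node c ε r) x _ (_ , rok , _ , bwr) bwx lok = lok , rok , bwx , bwr
attach-BW (node c l@(node a b d) r) x _ (lok′ , rok , bwl , bwr) bwx lok =
  subst (LeftOK c) (sym (attach-node a b d x)) (leftOK-root c a b d (attachLeftmost b x) d lok′)
  , rok , attach-BW l x tt bwl bwx lok , bwr

attach-BW⁻¹ : ∀ t x → IsNode t → IsBW (attachLeftmost t x) →
  IsBW t × IsBW x × LeftOK (leftmostColour t) x
attach-BW⁻¹ (node c ε r) x _ (lok , rok , bwx , bwr) = (tt , rok , tt , bwr) , bwx , lok
attach-BW⁻¹ (node c l@(node a b d) r) x _ (lok′ , rok , bwl , bwr)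
  with attach-BW⁻¹ l x tt bwl
... | bwl′ , bwx , lok =
  ( leftOK-root c a (attachLeftmost b x) d b d (subst (LeftOK c) (attach-node a b d x) lok′)
  , rok , bwl′ , bwr) , bwx , lok

attach-blackRoot : ∀ t x → BlackRoot t → BlackRoot (attachLeftmost t x)
attach-blackRoot (node black ε r)            x _ = tt
attach-blackRoot (node black (node _ _ _) r) x _ = tt

attach-blackRoot⁻¹ : ∀ t x → IsNode t → BlackRoot (attachLeftmost t x) → BlackRoot t
attach-blackRoot⁻¹ (node black l r)            x _ _ = tt
attach-blackRoot⁻¹ (node white ε r)            x _ ()
attach-blackRoot⁻¹ (node white (node _ _ _) r) x _ ()

blackRoot-isNode : ∀ t → BlackRoot t → IsNode t
blackRoot-isNode (node _ _ _) _ = tt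

attach-BWB : ∀ t x → IsBWB t → IsBW x → LeftOK (leftmostColour t) x → IsBWB (attachLeftmost t x)
attach-BWB t x (bwt , root) bwx lok =
  attach-BW t x (blackRoot-isNode t root) bwt bwx lok , attach-blackRoot t x root

-- The term BwtoL builds from the leftmost node (colour c, right subtree r),
-- given the value a on r and the value b on the rest of the tree.
decodeStep : Colour → Tree → Term → Term → Term
decodeStep black _            a b = sucT b
decodeStep white ε            a b = lam b
decodeStep white (node _ _ _) a b = app a b

-- One unfolding of BwtoL-fuel on t, given the recursive values a and b; this
-- mirrors the local function of BwtoL-fuel, including its junk cases.
stepValue : Colour → Tree → Tree → Term → Term → Term
stepValue _ _ ε                _ _ = var 𝟘
stepValue _ _ (node black ε ε) _ _ = var 𝟘
stepValue c r _                a b = decodeStep c r a b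

stepValue-hasLeftChild : ∀ c r u a b → HasLeftChild u → stepValue c r u a b ≡ decodeStep c r a b
stepValue-hasLeftChild c r (node black (node _ _ _) _) a b _ = refl
stepValue-hasLeftChild c r (node white (node _ _ _) _) a b _ = refl

unfold-fuel : ∀ k t → BwtoL-fuel (suc k) t ≡
  stepValue (leftmostColour t) (leftmostRight t) t
            (BwtoL-fuel k (leftmostRight t)) (BwtoL-fuel k (removeLeftmost t))
unfold-fuel k ε                           = refl
unfold-fuel k (node black ε ε)            = refl
unfold-fuel k (node black ε (node _ _ _)) = refl
unfold-fuel k (node white ε ε)            = refl
unfold-fuel k (node white ε (node _ _ _)) = refl
unfold-fuel k (node c (node a b d) r)
  with leftmostColour (node a b d) | leftmostRight (node a b d) | c
... | black | _          | black = refl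
... | black | _          | white = refl
... | white | ε          | black = refl
... | white | ε          | white = refl
... | white | node _ _ _ | black = refl
... | white | node _ _ _ | white = refl

fuel-irrelevant : ∀ k k′ t → size t ≤ k → size t ≤ k′ → BwtoL-fuel k t ≡ BwtoL-fuel k′ t
fuel-irrelevant zero    zero     t _ _ = refl
fuel-irrelevant zero    (suc k′) ε _ _ = refl
fuel-irrelevant (suc k) zero     ε _ _ = refl
fuel-irrelevant (suc k) (suc k′) t p q = begin
  BwtoL-fuel (suc k) t
    ≡⟨ unfold-fuel k t ⟩
  stepValue c r t (BwtoL-fuel k r) (BwtoL-fuel k t′)
    ≡⟨ cong₂ (stepValue c r t)
         (fuel-irrelevant k k′ r (leftmostRight-≤ k t p) (leftmostRight-≤ k′ t q))
         (fuel-irrelevant k k′ t′ (removeLeftmost-≤ k t p) (removeLeftmost-≤ k′ t q)) ⟩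
  stepValue c r t (BwtoL-fuel k′ r) (BwtoL-fuel k′ t′)
    ≡⟨ sym (unfold-fuel k′ t) ⟩
  BwtoL-fuel (suc k′) t ∎
  where
  c : Colour
  c = leftmostColour t
  r t′ : Tree
  r  = leftmostRight t
  t′ = removeLeftmost t

BwtoL-unfold : ∀ t → IsNode t →
  BwtoL t ≡ stepValue (leftmostColour t) (leftmostRight t) t
                      (BwtoL (leftmostRight t)) (BwtoL (removeLeftmost t))
BwtoL-unfold t@(node c l r) _ =
  trans (unfold-fuel k t)
        (cong₂ (stepValue (leftmostColour t) (leftmostRight t) t)
               (enough (leftmostRight t) (leftmostRight-≤ k t ≤-refl))
               (enough (removeLeftmost t) (removeLeftmost-≤ k t ≤-refl)))
  where
  k : ℕ
  k = size l + size r
  enough : ∀ u → size u ≤ k → BwtoL-fuel k u ≡ BwtoL u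
  enough u p = fuel-irrelevant k (size u) u p ≤-refl

BwtoL-attach : ∀ c r t → IsNode t →
  BwtoL (attachLeftmost t (node c ε r)) ≡ decodeStep c r (BwtoL r) (BwtoL t)
BwtoL-attach c r t nt = begin
  BwtoL u
    ≡⟨ BwtoL-unfold u (attach-isNode t x tt) ⟩
  stepValue (leftmostColour u) (leftmostRight u) u (BwtoL (leftmostRight u)) (BwtoL (removeLeftmost u))
    ≡⟨ cong₂ (λ c′ r′ → stepValue c′ r′ u (BwtoL r′) (BwtoL (removeLeftmost u)))
             (attach-leftmostColour c r t) (attach-leftmostRight c r t) ⟩
  stepValue c r u (BwtoL r) (BwtoL (removeLeftmost u))
    ≡⟨ cong (λ t′ → stepValue c r u (BwtoL r) (BwtoL t′)) (attach-removeLeftmost c r t) ⟩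
  stepValue c r u (BwtoL r) (BwtoL t)
    ≡⟨ stepValue-hasLeftChild c r u (BwtoL r) (BwtoL t) (attach-hasLeftChild t x nt tt) ⟩
  decodeStep c r (BwtoL r) (BwtoL t) ∎
  where
  x u : Tree
  x = node c ε r
  u = attachLeftmost t x

LtoBwIdx-S : ∀ i → LtoBwIdx (S i) ≡ node black (LtoBwIdx i) ε
LtoBwIdx-S 𝟘     = refl
LtoBwIdx-S (S i) = begin
  attachLeftmost (LtoBwIdx (S i)) blackLeaf            ≡⟨ cong (λ u → attachLeftmost u blackLeaf) (LtoBwIdx-S i) ⟩
  attachLeftmost (node black (LtoBwIdx i) ε) blackLeaf ≡⟨ attach-node black (LtoBwIdx i) ε blackLeaf ⟩
  node black (LtoBwIdx (S i)) ε                        ∎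
  where
  blackLeaf : Tree
  blackLeaf = node black ε ε

LtoBwIdx-BWB : ∀ i → IsBWB (LtoBwIdx i)
LtoBwIdx-BWB 𝟘     = (tt , tt , tt , tt) , tt
LtoBwIdx-BWB (S i) rewrite LtoBwIdx-S i =
  (leftOK-black (LtoBwIdx i) , tt , proj₁ (LtoBwIdx-BWB i) , tt) , tt

rightOK-white : ∀ t → IsBWB t → RightOK white t
rightOK-white (node black _ _) _ = refl

LtoBw-BWB : ∀ M → IsBWB (LtoBw M)
LtoBw-BWB (var i)   = LtoBwIdx-BWB i
LtoBw-BWB (lam M)   =
  attach-BWB (LtoBw M) (node white ε ε) (LtoBw-BWB M) (tt , tt , tt , tt)
             (leftOK-white (leftmostColour (LtoBw M)) ε ε)
LtoBw-BWB (app M N) =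
  attach-BWB (LtoBw N) (node white ε (LtoBw M)) (LtoBw-BWB N)
             (tt , rightOK-white (LtoBw M) (LtoBw-BWB M) , tt , proj₁ (LtoBw-BWB M))
             (leftOK-white (leftmostColour (LtoBw N)) ε (LtoBw M))

LtoBw-isNode : ∀ M → IsNode (LtoBw M)
LtoBw-isNode M = blackRoot-isNode (LtoBw M) (proj₂ (LtoBw-BWB M))

decodeStep-app : ∀ r a b → IsNode r → decodeStep white r a b ≡ app a b
decodeStep-app (node _ _ _) a b _ = refl

BwtoL-LtoBwIdx : ∀ i → BwtoL (LtoBwIdx i) ≡ var i
BwtoL-LtoBwIdx 𝟘     = refl
BwtoL-LtoBwIdx (S i) =
  trans (BwtoL-attach black ε (LtoBwIdx i) (LtoBw-isNode (var i)))
        (cong sucT (BwtoL-LtoBwIdx i))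

BwtoL-LtoBw : ∀ M → BwtoL (LtoBw M) ≡ M
BwtoL-LtoBw (var i)   = BwtoL-LtoBwIdx i
BwtoL-LtoBw (lam M)   =
  trans (BwtoL-attach white ε (LtoBw M) (LtoBw-isNode M)) (cong lam (BwtoL-LtoBw M))
BwtoL-LtoBw (app M N) = begin
  BwtoL (attachLeftmost (LtoBw N) (node white ε (LtoBw M)))
    ≡⟨ BwtoL-attach white (LtoBw M) (LtoBw N) (LtoBw-isNode N) ⟩
  decodeStep white (LtoBw M) (BwtoL (LtoBw M)) (BwtoL (LtoBw N))
    ≡⟨ decodeStep-app (LtoBw M) _ _ (LtoBw-isNode M) ⟩
  app (BwtoL (LtoBw M)) (BwtoL (LtoBw N))
    ≡⟨ cong₂ app (BwtoL-LtoBw M) (BwtoL-LtoBw N) ⟩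
  app M N ∎

Image : Tree → Set
Image t = Σ Term λ M → LtoBw M ≡ t

whiteRoot-leftmost : ∀ l r → IsBW (node white l r) → leftmostColour (node white l r) ≡ white
whiteRoot-leftmost ε                r _                   = refl
whiteRoot-leftmost (node .white l r) _ (refl , _ , bwl , _) = whiteRoot-leftmost l r bwl

blackChain-index : ∀ t → IsBWB t → leftmostColour t ≡ black → Σ Index λ i → LtoBwIdx i ≡ t
blackChain-index (node black ε ε)                     _ _ = 𝟘 , refl
blackChain-index (node black ε (node _ _ _))          ((_ , () , _) , _) _
blackChain-index (node black (node _ _ _) (node _ _ _)) ((_ , () , _) , _) _
blackChain-index (node black (node black l r) ε) ((_ , _ , bwl , _) , _) e
  with blackChain-index (node black l r) (bwl , tt) e
... | i , eq = S i , trans (LtoBwIdx-S i) (cong (λ u → node black u ε) eq)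
blackChain-index (node black (node white l r) ε) ((_ , _ , bwl , _) , _) e
  with trans (sym (whiteRoot-leftmost l r bwl)) e
... | ()

leftOK-blackLeaf : ∀ c → LeftOK c (node black ε ε) → c ≡ black
leftOK-blackLeaf black _ = refl

image-attach : ∀ n t c r → IsNode t → size t ≤ n → size r ≤ n →
  (∀ u → size u ≤ n → IsBWB u → Image u) →
  IsBWB (attachLeftmost t (node c ε r)) → Image (attachLeftmost t (node c ε r))
image-attach n t c r nt st sr image< (bw , root)
  with attach-BW⁻¹ t (node c ε r) nt bw
... | bwt , (_ , rok , _ , bwr) , lok = go c r sr rok bwr lok
  where
  bwbt : IsBWB t
  bwbt = bwt , attach-blackRoot⁻¹ t _ nt root

  go : ∀ c r → size r ≤ n → RightOK c r → IsBW r → LeftOK (leftmostColour t) (node c ε r) →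
       Image (attachLeftmost t (node c ε r))
  go black ε _ _ _ lok′
    with blackChain-index t bwbt (leftOK-blackLeaf (leftmostColour t) lok′)
  ... | i , refl = var (S i) , refl
  go white ε _ _ _ _ with image< t st bwbt
  ... | M , refl = lam M , refl
  go white r@(node black _ _) sr′ _ bwr′ _
    with image< t st bwbt | image< r sr′ (bwr′ , tt)
  ... | N , eqN | M , eqM = app M N , cong₂ (λ u v → attachLeftmost u (node white ε v)) eqN eqM

-- Every black-white tree with black root of size at most n is in the image,
-- by induction on n via the leftmost decomposition.
image : ∀ n t → size t ≤ n → IsBWB t → Image t
image n (node black ε ε)                       _ _ = var 𝟘 , refl
image n (node black ε (node _ _ _))            _ ((_ , () , _) , _)
image n (node black (node _ _ _) (node _ _ _)) _ ((_ , () , _) , _)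
image (suc n) t@(node black (node _ _ _) ε) sz bwb =
  subst Image (sym (decompose t tt))
    (image-attach n (removeLeftmost t) (leftmostColour t) (leftmostRight t) tt
      (removeLeftmost-≤ n t sz) (leftmostRight-≤ n t sz) (image n)
      (subst IsBWB (decompose t tt) bwb))

LtoBw-BwtoL : ∀ t → IsBWB t → LtoBw (BwtoL t) ≡ t
LtoBw-BwtoL t bwb with image (size t) t ≤-refl bwb
... | M , refl = cong LtoBw (BwtoL-LtoBw M)


mainTheorem3 : ((M : Term) → IsBWB (LtoBw M))
    × ((M : Term) → BwtoL (LtoBw M) ≡ M)
    × ((t : Tree) → IsBWB t → LtoBw (BwtoL t) ≡ t)
mainTheorem3 = LtoBw-BWB , BwtoL-LtoBw , LtoBw-BwtoL
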